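{- Let $\mathcal{L}$ be a choice logic and $A,B$ $\mathcal{L}$-formulas. Then $A$ and $B$ are fully equivalent if and only if, for every $\mathcal{L}$-formula $F$, $F$ and $F[A/B]$ are fully equivalent.
   Context: Let $\mathcal{U}$ be an infinite set of propositional variables; an interpretation is a set $\mathcal{I}\subseteq\mathcal{U}$. Write $\overline{\mathbb{N}}=\mathbb{N}\cup\{\infty\}$. A choice logic $\mathcal{L}$ is given by a finite set $C_{\mathcal{L}}$ of binary connective symbols disjoint from $\{\neg,\wedge,\vee\}$ and for each $\circ\in C_{\mathcal{L}}$ functions $\mathrm{opt}_\circ:\mathbb{N}^2\to\mathbb{N}$ with $\mathrm{opt}_\circ(k,\ell)\le(k+1)(\ell+1)$ and $\deg_\circ:\mathbb{N}^2\times\overline{\mathbb{N}}^2\to\overline{\mathbb{N}}$ with $\deg_\circ(k,\ell,m,n)\le\mathrm{opt}_\circ(k,\ell)$ or $=\infty$. Formulas: variables, $(\neg F)$, $(F\circ G)$ for $\circ\in\{\wedge,\vee\}\cup C_{\mathcal{L}}$. $\mathrm{opt}_{\mathcal{L}}(a)=\mathrm{opt}_{\mathcal{L}}(\neg F)=1$; $\mathrm{opt}_{\mathcal{L}}(F\wedge G)=\mathrm{opt}_{\mathcal{L}}(F\vee G)=\max(\mathrm{opt}_{\mathcal{L}}(F),\mathrm{opt}_{\mathcal{L}}(G))$; $\mathrm{opt}_{\mathcal{L}}(F\circ G)=\mathrm{opt}_\circ(\mathrm{opt}_{\mathcal{L}}(F),\mathrm{opt}_{\mathcal{L}}(G))$.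 $\deg_{\mathcal{L}}(\mathcal{I},a)=1$ if $a\in\mathcal{I}$ else $\infty$; $\deg_{\mathcal{L}}(\mathcal{I},\neg F)=1$ if $\deg_{\mathcal{L}}(\mathcal{I},F)=\infty$ else $\infty$; $\wedge$: max, $\vee$: min of operand degrees; $\deg_{\mathcal{L}}(\mathcal{I},F\circ G)=\deg_\circ(\mathrm{opt}_{\mathcal{L}}(F),\mathrm{opt}_{\mathcal{L}}(G),\deg_{\mathcal{L}}(\mathcal{I},F),\deg_{\mathcal{L}}(\mathcal{I},G))$. $F[A/B]$ denotes the result of substituting an occurrence of $A$ in $F$ by $B$. Two formulas are fully equivalent if they have the same degree under every interpretation and the same optionality. -}

module Defs where

open import Data.Nat using (ℕ; zero; suc; _+_; _*_; _≤_; _⊔_; _⊓_)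
open import Data.Fin using (Fin)
open import Data.Bool using (Bool; true; false; if_then_else_)
open import Data.Product using (Σ; _×_; _,_)
open import Data.Sum using (_⊎_)
open import Relation.Binary.PropositionalEquality using (_≡_)

data ℕ∞ : Set where
  fin : ℕ → ℕ∞
  ∞   : ℕ∞

max∞ : ℕ∞ → ℕ∞ → ℕ∞
max∞ ∞ _ = ∞
max∞ (fin _) ∞ = ∞
max∞ (fin m) (fin n) = fin (m ⊔ n)

min∞ : ℕ∞ → ℕ∞ → ℕ∞
min∞ ∞ d = d
min∞ (fin m) ∞ = fin m
min∞ (fin m) (fin n) = fin (m ⊓ n)

BoundedOrInf : ℕ∞ → ℕ → Set
BoundedOrInf d k = (Σ ℕ λ m → d ≡ fin m × m ≤ k) ⊎ d ≡ ∞

record ChoiceLogic : Set where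
  field
    size   : ℕ
    optC   : Fin size → ℕ → ℕ → ℕ
    degC   : Fin size → ℕ → ℕ → ℕ∞ → ℕ∞ → ℕ∞
    optC-bound : ∀ c k l → optC c k l ≤ suc k * suc l
    degC-bound : ∀ c k l m n → BoundedOrInf (degC c k l m n) (optC c k l)

module _ (L : ChoiceLogic) where
  open ChoiceLogic L

  data Op : Set where
    andᵒ : Op
    orᵒ  : Op
    chc  : Fin size → Op

  data Form : Set where
    var : ℕ → Form
    neg : Form → Form
    bin : Op → Form → Form → Form

  -- interpretations: subsets of 𝒰 = ℕ, given by characteristic function
  Interp : Set
  Interp = ℕ → Bool

  opt : Form → ℕ
  opt (var _) = 1
  opt (neg _) = 1
  opt (bin andᵒ F G) = opt F ⊔ opt G
  opt (bin orᵒ F G) = opt F ⊔ opt G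
  opt (bin (chc c) F G) = optC c (opt F) (opt G)

  deg : Interp → Form → ℕ∞
  deg I (var a) = if I a then fin 1 else ∞
  deg I (neg F) with deg I F
  ... | ∞ = fin 1
  ... | fin _ = ∞
  deg I (bin andᵒ F G) = max∞ (deg I F) (deg I G)
  deg I (bin orᵒ F G) = min∞ (deg I F) (deg I G)
  deg I (bin (chc c) F G) = degC c (opt F) (opt G) (deg I F) (deg I G)

  FullyEquivalent : Form → Form → Set
  FullyEquivalent F G = ((I : Interp) → deg I F ≡ deg I G) × opt F ≡ opt G

  data Occ (A : Form) : Form → Set where
    here : Occ A A
    inNeg : ∀ {F} → Occ A F → Occ A (neg F)
    inL : ∀ {F} o G → Occ A F → Occ A (bin o F G)
    inR : ∀ o F {G} → Occ A G → Occ A (bin o F G)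

  -- F[A/B]: replace the given occurrence of A in F by B
  replace : ∀ {A F} → Occ A F → Form → Form
  replace here B = B
  replace (inNeg p) B = neg (replace p B)
  replace (inL o G p) B = bin o (replace p B) G
  replace (inR o F p) B = bin o F (replace p B)

module Submission where

open import Defs
open import Data.Nat using (_⊔_)
open import Data.Product using (_,_)
open import Function.Bundles using (_⇔_; mk⇔)
open import Relation.Binary.PropositionalEquality using (_≡_; refl; cong₂; trans)

-- Degree and optionality of a compound formula depend on its immediate
-- subformulas only through their degrees and optionalities, so full
-- equivalence is a congruence; replacing an occurrence is then induction
-- on the path to that occurrence.

module _ (L : ChoiceLogic) where
  open ChoiceLogic L

  FullyEquivalent-refl : ∀ F → FullyEquivalent L F F
  FullyEquivalent-refl F = (λ I → refl) , refl

  neg-cong : ∀ {F G} → FullyEquivalent L F G → FullyEquivalent L (neg F) (neg G)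
  neg-cong {F} {G} (deg≡ , _) = degNeg≡ , refl
    where
    degNeg≡ : ∀ I → deg L I (neg F) ≡ deg L I (neg G)
    degNeg≡ I with deg L I F | deg L I G | deg≡ I
    ... | fin _ | fin _ | _    = refl
    ... | ∞     | ∞     | refl = refl

  bin-cong : ∀ o {F F′ G G′} → FullyEquivalent L F F′ → FullyEquivalent L G G′ →
             FullyEquivalent L (bin o F G) (bin o F′ G′)
  bin-cong andᵒ (degF , optF) (degG , optG) =
    (λ I → cong₂ max∞ (degF I) (degG I)) , cong₂ _⊔_ optF optG
  bin-cong orᵒ (degF , optF) (degG , optG) =
    (λ I → cong₂ min∞ (degF I) (degG I)) , cong₂ _⊔_ optF optG
  bin-cong (chc c) {F} {F′} {G} {G′} (degF , optF) (degG , optG) =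
    (λ I → trans (cong₂ (λ k l → degC c k l (deg L I F) (deg L I G)) optF optG)
                 (cong₂ (degC c (opt L F′) (opt L G′)) (degF I) (degG I))) ,
    cong₂ (optC c) optF optG

  replace-cong : ∀ {A F} (p : Occ L A F) (B : Form L) → FullyEquivalent L A B →
                 FullyEquivalent L F (replace L p B)
  -- FullyEquivalent unfolds to statements about deg and opt, which do not
  -- determine the formulas, so they are passed to the congruences explicitly.
  replace-cong here B A≈B = A≈B
  replace-cong (inNeg {F} p) B A≈B =
    neg-cong {F} {replace L p B} (replace-cong p B A≈B)
  replace-cong (inL {F} o G p) B A≈B =
    bin-cong o {F} {replace L p B} {G} {G} (replace-cong p B A≈B) (FullyEquivalent-refl G)
  replace-cong (inR o F {G} p) B A≈B =
    bin-cong o {F} {F} {G} {replace L p B} (FullyEquivalent-refl F) (replace-cong p B A≈B)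

lemma5 : (L : ChoiceLogic) (A B : Form L) →
    FullyEquivalent L A B ⇔
      ((F : Form L) (p : Occ L A F) → FullyEquivalent L F (replace L p B))
lemma5 L A B = mk⇔ (λ A≈B F p → replace-cong L p B A≈B) (λ h → h A here)
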